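{- Let $q$ be a prime power, $k\ge2$, and let $D\subseteq\mathbb{F}_q^k\setminus\{0\}$ be a vectorial cutting blocking set with $aD=D$ for every $a\in\mathbb{F}_q^*$; put $n=\#D$. Let $\widetilde{[D,D]}=\{(x,1):x\in D\}\cup\{(x,0):x\in D\}\subseteq\mathbb{F}_q^{k+1}$. For $\alpha=(\alpha_1,\dots,\alpha_{k+1})\in\mathbb{F}_q^{k+1}$ let $c_\alpha=(c_{\alpha,0},c_{\alpha,1})\in\mathrm{C}_{\widetilde{[D,D]}}$ with $c_{\alpha,0}=(\alpha\cdot(x,0))_{x\in D}$ and $c_{\alpha,1}=(\alpha\cdot(x,1))_{x\in D}$, and let $\tilde\alpha=(\alpha_1,\dots,\alpha_k)$ and $c_{\tilde\alpha}=(\tilde\alpha\cdot x)_{x\in D}\in\mathrm{C}_D$. Then: (i) if $\alpha_{k+1}=0$, then $\mathrm{w}(c_{\alpha,1})=\mathrm{w}(c_{\alpha,0})$ and $\mathrm{w}(c_\alpha)=2\,\mathrm{w}(c_{\tilde\alpha})$; (ii) if $\alpha_{k+1}\neq0$, then $\mathrm{w}(c_\alpha)=n+\frac{q-2}{q-1}\,\mathrm{w}(c_{\tilde\alpha})$.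
   Context: For a finite list $D$ of points of $\mathbb{F}_q^m$, $\mathrm{C}_D=\{(a\cdot P)_{P\in D}:a\in\mathbb{F}_q^m\}$; $\mathrm{w}$ is the Hamming weight. A set $M\subseteq\mathbb{F}_q^k$ is a vectorial cutting blocking set if for every $(k-1)$-dimensional linear subspace $H$ of $\mathbb{F}_q^k$, the span of $M\cap H$ equals $H$. -}

module Defs where

open import Level using (0ℓ)
open import Data.Nat using (ℕ; zero; suc)
open import Data.Fin using (Fin; zero; suc)
open import Data.List using (allFin)
open import Data.Nat using (_∸_)
open import Data.List using (List; []; _∷_; length; map; filter; _++_)
open import Data.List.Membership.Propositional using (_∈_)
open import Data.List.Relation.Unary.Any using (Any)
open import Data.List.Relation.Unary.All using (All)
open import Data.List.Relation.Unary.AllPairs using (AllPairs)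
open import Data.List.Relation.Unary.Unique.Propositional using (Unique)
open import Data.Product using (Σ; _×_; ∃; _,_; proj₂)
open import Relation.Nullary using (¬_; Dec)
open import Relation.Nullary.Decidable using (¬?)
open import Relation.Binary.PropositionalEquality using (_≡_)
open import Algebra.Structures using (IsCommutativeRing)

record FiniteField : Set₁ where
  infixl 6 _+_
  infixl 7 _*_
  field
    Carrier   : Set
    _+_ _*_   : Carrier → Carrier → Carrier
    -_        : Carrier → Carrier
    0# 1#     : Carrier
    isCommutativeRing : IsCommutativeRing _≡_ _+_ _*_ -_ 0# 1#
    0≢1       : ¬ (0# ≡ 1#)
    _⁻¹       : Carrier → Carrier
    inverse   : ∀ x → ¬ (x ≡ 0#) → x * (x ⁻¹) ≡ 1#
    _≟_       : (x y : Carrier) → Dec (x ≡ y)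
    elements  : List Carrier
    complete  : ∀ x → x ∈ elements
    distinct  : Unique elements

  order : ℕ
  order = length elements

module _ (F : FiniteField) where
  open FiniteField F

  Vec : ℕ → Set
  Vec m = Fin m → Carrier

  zeroV : ∀ {m} → Vec m
  zeroV _ = 0#

  _≈_ : ∀ {m} → Vec m → Vec m → Set
  u ≈ v = ∀ i → u i ≡ v i

  _·ᵥ_ : ∀ {m} → Carrier → Vec m → Vec m
  (a ·ᵥ v) i = a * v i

  _+ᵥ_ : ∀ {m} → Vec m → Vec m → Vec m
  (u +ᵥ v) i = u i + v i

  dot : ∀ {m} → Vec m → Vec m → Carrier
  dot {zero}  a p = 0#
  dot {suc m} a p = a zero * p zero + dot (λ i → a (suc i)) (λ i → p (suc i))

  _∈ᵥ_ : ∀ {m} → Vec m → List (Vec m) → Set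
  x ∈ᵥ D = Any (λ y → x ≈ y) D

  -- a list of vectors without repetitions, i.e. a finite set of points
  NoDup : ∀ {m} → List (Vec m) → Set
  NoDup D = AllPairs (λ u v → ¬ (u ≈ v)) D

  codeword : ∀ {m} → List (Vec m) → Vec m → List Carrier
  codeword D a = map (dot a) D

  weight : List Carrier → ℕ
  weight c = length (filter (λ x → ¬? (x ≟ 0#)) c)

  lincomb : ∀ {m} → List (Carrier × Vec m) → Vec m
  lincomb []             = zeroV
  lincomb ((c , v) ∷ cs) = (c ·ᵥ v) +ᵥ lincomb cs

  InSpan : ∀ {m} → (Vec m → Set) → Vec m → Set
  InSpan S x = Σ (List (Carrier × Vec _)) λ cs →
                 All (λ p → S (proj₂ p)) cs × (x ≈ lincomb cs)

  LinIndep : ∀ {m r} → (Fin r → Vec m) → Set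
  LinIndep {m} {r} b = ∀ (c : Fin r → Carrier) →
    lincomb (map (λ j → (c j , b j)) (allFin r)) ≈ zeroV →
    ∀ j → c j ≡ 0#

  SpanOf : ∀ {m r} → (Fin r → Vec m) → Vec m → Set
  SpanOf b = InSpan (λ v → ∃ λ j → v ≈ b j)

  -- M ⊆ F_q^k is a vectorial cutting blocking set: for every
  -- (k-1)-dimensional subspace H = ⟨b_1,…,b_{k-1}⟩ (b linearly independent),
  -- ⟨M ∩ H⟩ = H.
  VectorialCuttingBlockingSet : (k : ℕ) → List (Vec k) → Set
  VectorialCuttingBlockingSet k M =
    ∀ (b : Fin (k ∸ 1) → Vec k) → LinIndep b →
      (∀ x → SpanOf b x → InSpan (λ v → (v ∈ᵥ M) × SpanOf b v) x)
      × (∀ x → InSpan (λ v → (v ∈ᵥ M) × SpanOf b v) x → SpanOf b x)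

  -- (x , a) ∈ F_q^{k+1}, the last coordinate being a
  extend : ∀ {k} → Vec k → Carrier → Vec (suc k)
  extend {zero}  v a zero    = a
  extend {suc k} v a zero    = v zero
  extend {suc k} v a (suc i) = extend (λ j → v (suc j)) a i

  tildeDD : ∀ {k} → List (Vec k) → List (Vec (suc k))
  tildeDD D = map (λ x → extend x 1#) D ++ map (λ x → extend x 0#) D

module Submission where

-- Write f(x) = α~ · x and b = α_{k+1}.  Since (x,c) · α = f(x) + b c, the
-- codeword c_α is the concatenation of c_{α,1} = (f(x) + b)_x and
-- c_{α,0} = (f(x))_x = c_{α~}.  If b = 0 both halves equal c_{α~}, giving (i).
--
-- For b ≠ 0 the key point is that the level sets D_t = {x ∈ D : f(x) = t},
-- t ≠ 0, all have the same size N: multiplication by s t⁻¹ maps D_t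
-- injectively into D_s because D is closed under nonzero scalars.  Splitting
-- w(c_{α~}) into the q-1 nonzero fibres gives w(c_{α~}) = (q-1) N, while
-- w(c_{α,1}) = n - #D_{-b} = n - N.  Hence w(c_α) = n - N + (q-1) N, and
-- multiplying by q-1 yields (ii) in the division-free form of the statement.

open import Defs
open import Level using (0ℓ)
open import Algebra.Bundles using (CommutativeRing)
import Algebra.Properties.CommutativeSemigroup as CommSemigroupProperties
import Algebra.Properties.Ring as RingProperties
open import Data.Bool using (true; false; if_then_else_)
open import Data.Empty using (⊥-elim)
open import Data.Fin using (Fin; zero; suc; fromℕ; inject₁)
open import Data.List using (List; []; _∷_; length; map; filter; _++_)
open import Data.List.Properties using (length-++; length-map; length-removeAt′; map-++; map-∘; map-cong; filter-++; filter-≐; filter-none)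
open import Data.List.Membership.Propositional using (_∈_)
open import Data.List.Membership.Propositional.Properties using (∈-filter⁺; ∈-length)
open import Data.List.Relation.Unary.All using (All; []; _∷_)
import Data.List.Relation.Unary.All as All
import Data.List.Relation.Unary.All.Properties as AllP
open import Data.List.Relation.Unary.AllPairs using ([]; _∷_)
open import Data.List.Relation.Unary.Any using (here; there; _─_)
import Data.List.Relation.Unary.Any as Any
open import Data.List.Relation.Unary.Unique.Propositional using (Unique)
import Data.List.Relation.Unary.Unique.Propositional.Properties as UniqueP
import Data.List.Relation.Unary.Unique.Setoid.Properties as SetoidUniqueP
open import Data.Nat using (ℕ; zero; suc; _≤_; _+_; _*_; _∸_; z≤n; s≤s)
open import Data.Nat.ListAction using (sum)
open import Data.Nat.Properties using (+-suc; *-zeroʳ; ≤-antisym) renaming (+-identityʳ to +-identityʳ-ℕ)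
open import Data.Nat.Solver using (module +-*-Solver)
open import Data.Product using (_×_; Σ; _,_)
open import Relation.Binary using (Setoid; DecidableEquality)
open import Relation.Binary.PropositionalEquality using (_≡_; refl; sym; trans; cong; cong₂; subst; module ≡-Reasoning)
open import Relation.Nullary using (¬_; Dec; yes; no; does)
open import Relation.Nullary.Decidable using (¬?)
open import Relation.Unary using (Pred; Decidable; _≐_)

indicator : {P : Set} → Dec P → ℕ
indicator P? = if does P? then 1 else 0

module Counting {A : Set} where

  count : {P : Pred A 0ℓ} → Decidable P → List A → ℕ
  count P? xs = length (filter P? xs)

  count-∷ : {P : Pred A 0ℓ} (P? : Decidable P) (x : A) (xs : List A) →
            count P? (x ∷ xs) ≡ indicator (P? x) + count P? xs
  count-∷ P? x xs with does (P? x)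
  ... | true  = refl
  ... | false = refl

  count-complement : {P : Pred A 0ℓ} (P? : Decidable P) (xs : List A) →
                     length xs ≡ count P? xs + count (λ x → ¬? (P? x)) xs
  count-complement P? []       = refl
  count-complement P? (x ∷ xs) with P? x
  ... | yes _ = cong suc (count-complement P? xs)
  ... | no  _ = trans (cong suc (count-complement P? xs)) (sym (+-suc _ _))

  count-≐ : {P Q : Pred A 0ℓ} (P? : Decidable P) (Q? : Decidable Q) →
            P ≐ Q → (xs : List A) → count P? xs ≡ count Q? xs
  count-≐ P? Q? P≐Q xs = cong length (filter-≐ P? Q? P≐Q xs)

  count-none : {P : Pred A 0ℓ} (P? : Decidable P) {xs : List A} →
               All (λ x → ¬ P x) xs → count P? xs ≡ 0
  count-none P? none = cong length (filter-none P? none)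

  count-unique : {P : Pred A 0ℓ} (P? : Decidable P) {y : A} → P y →
                 (∀ t → P t → t ≡ y) → {xs : List A} → Unique xs → y ∈ xs →
                 count P? xs ≡ 1
  count-unique P? {y} Py only {x ∷ xs} (x∉xs ∷ _) (here refl) with P? x
  ... | yes _   = cong suc (count-none P? (All.map (λ x≢t Pt → x≢t (sym (only _ Pt))) x∉xs))
  ... | no ¬Px  = ⊥-elim (¬Px Py)
  count-unique P? Py only {x ∷ xs} (x∉xs ∷ xs!) (there y∈xs) with P? x
  ... | yes Px = ⊥-elim (All.lookup x∉xs y∈xs (only x Px))
  ... | no  _  = count-unique P? Py only xs! y∈xs

  sum-map-+ : (f g : A → ℕ) (xs : List A) →
              sum (map (λ t → f t + g t) xs) ≡ sum (map f xs) + sum (map g xs)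
  sum-map-+ f g []       = refl
  sum-map-+ f g (x ∷ xs) rewrite sum-map-+ f g xs = interchange (f x) (g x) _ _
    where
    open +-*-Solver
    interchange : ∀ a b c d → (a + b) + (c + d) ≡ (a + c) + (b + d)
    interchange = solve 4 (λ a b c d → (a :+ b) :+ (c :+ d) := (a :+ c) :+ (b :+ d)) refl

  sum-map-const : (f : A → ℕ) (c : ℕ) {xs : List A} →
                  All (λ t → f t ≡ c) xs → sum (map f xs) ≡ length xs * c
  sum-map-const f c []         = refl
  sum-map-const f c (ft ∷ fts) = cong₂ _+_ ft (sum-map-const f c fts)

  sum-indicator : {P : Pred A 0ℓ} (P? : Decidable P) (xs : List A) →
                  sum (map (λ t → indicator (P? t)) xs) ≡ count P? xs
  sum-indicator P? []       = refl
  sum-indicator P? (x ∷ xs) =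
    trans (cong (indicator (P? x) +_) (sum-indicator P? xs)) (sym (count-∷ P? x xs))

open Counting

module Fibres {B : Set} (_≟_ : DecidableEquality B) {P : Pred B 0ℓ} (P? : Decidable P)
              (E : List B) (E! : Unique E) (P⇒∈E : ∀ {y} → P y → y ∈ E) (E⊆P : All P E) where

  indicator-as-count : (y : B) → count (λ t → y ≟ t) E ≡ indicator (P? y)
  indicator-as-count y with P? y
  ... | yes Py = count-unique (λ t → y ≟ t) refl (λ t y≡t → sym y≡t) E! (P⇒∈E Py)
  ... | no ¬Py = count-none (λ t → y ≟ t) (All.map (λ Pt y≡t → ¬Py (subst P (sym y≡t) Pt)) E⊆P)

  count-by-fibres : {A : Set} (g : A → B) (xs : List A) →
                    count (λ x → P? (g x)) xs ≡ sum (map (λ t → count (λ x → g x ≟ t) xs) E)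
  count-by-fibres g []       =
    sym (trans (sum-map-const (λ _ → 0) 0 {E} (All.tabulate (λ _ → refl))) (*-zeroʳ (length E)))
  count-by-fibres g (x ∷ xs) = begin
    count (λ x → P? (g x)) (x ∷ xs)
      ≡⟨ count-∷ (λ x → P? (g x)) x xs ⟩
    indicator (P? (g x)) + count (λ x → P? (g x)) xs
      ≡⟨ cong₂ _+_ (sym (trans (sum-indicator (λ t → g x ≟ t) E) (indicator-as-count (g x))))
                   (count-by-fibres g xs) ⟩
    sum (map (λ t → indicator (g x ≟ t)) E) + sum (map (λ t → count (λ x → g x ≟ t) xs) E)
      ≡⟨ sym (sum-map-+ (λ t → indicator (g x ≟ t)) (λ t → count (λ x → g x ≟ t) xs) E) ⟩
    sum (map (λ t → indicator (g x ≟ t) + count (λ x → g x ≟ t) xs) E)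
      ≡⟨ cong sum (map-cong (λ t → sym (count-∷ (λ x → g x ≟ t) x xs)) E) ⟩
    sum (map (λ t → count (λ x → g x ≟ t) (x ∷ xs)) E) ∎
    where open ≡-Reasoning

module Pigeonhole {c ℓ} (S : Setoid c ℓ) where
  open Setoid S using () renaming (_≈_ to _≈ₛ_; sym to symₛ; trans to transₛ)
  open import Data.List.Membership.Setoid S using () renaming (_∈_ to _∈ₛ_)
  open import Data.List.Relation.Unary.Unique.Setoid S using () renaming (Unique to Uniqueₛ)

  ∈-─ : ∀ {x y ys} (x∈ys : x ∈ₛ ys) → y ∈ₛ ys → ¬ x ≈ₛ y → y ∈ₛ (ys ─ x∈ys)
  ∈-─ (here x≈z)  (here y≈z)  x≉y = ⊥-elim (x≉y (transₛ x≈z (symₛ y≈z)))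
  ∈-─ (here _)    (there y∈)  _   = y∈
  ∈-─ (there _)   (here y≈z)  _   = here y≈z
  ∈-─ (there x∈)  (there y∈)  x≉y = there (∈-─ x∈ y∈ x≉y)

  -- Map x to an occurrence in ys, remove it, and recurse.
  length-≤ : ∀ {xs ys} → Uniqueₛ xs → All (_∈ₛ ys) xs → length xs ≤ length ys
  length-≤ {[]}     _             _              = z≤n
  length-≤ {x ∷ xs} {ys} (x≉xs ∷ xs!) (x∈ys ∷ xs⊆ys) rewrite length-removeAt′ ys (Any.index x∈ys) =
    s≤s (length-≤ xs! (All.zipWith (λ (y∈ys , x≉y) → ∈-─ x∈ys y∈ys x≉y) (xs⊆ys , x≉xs)))

module FieldFacts (F : FiniteField) where
  open FiniteField F renaming (_+_ to _⊕_; _*_ to _⊛_)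

  commutativeRing : CommutativeRing 0ℓ 0ℓ
  commutativeRing = record
    { Carrier = Carrier ; _≈_ = _≡_ ; _+_ = _⊕_ ; _*_ = _⊛_ ; -_ = -_
    ; 0# = 0# ; 1# = 1# ; isCommutativeRing = isCommutativeRing }

  open CommutativeRing commutativeRing using
    (+-assoc; +-identityˡ; +-identityʳ; -‿inverseˡ; *-assoc; *-comm; *-identityˡ;
     distribˡ; zeroʳ; ring; *-commutativeSemigroup)
  open RingProperties ring using (+-inverseˡ-unique; -0#≈0#; -‿injective)
  open CommSemigroupProperties *-commutativeSemigroup using (x∙yz≈y∙xz)

  vecSetoid : ℕ → Setoid 0ℓ 0ℓ
  vecSetoid m = record
    { Carrier = Defs.Vec F m ; _≈_ = _≈_ F
    ; isEquivalence = record
      { refl = λ _ → refl ; sym = λ e i → sym (e i) ; trans = λ e e′ i → trans (e i) (e′ i) } }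

  dot-resp : ∀ {m} (a : Defs.Vec F m) {x y : Defs.Vec F m} → _≈_ F x y → dot F a x ≡ dot F a y
  dot-resp {zero}  a x≈y = refl
  dot-resp {suc m} a x≈y =
    cong₂ _⊕_ (cong (a zero ⊛_) (x≈y zero)) (dot-resp (λ i → a (suc i)) (λ i → x≈y (suc i)))

  dot-scale : ∀ {m} (a : Defs.Vec F m) (c : Carrier) (x : Defs.Vec F m) →
              dot F a (_·ᵥ_ F c x) ≡ c ⊛ dot F a x
  dot-scale {zero}  a c x = sym (zeroʳ c)
  dot-scale {suc m} a c x = begin
    a zero ⊛ (c ⊛ x zero) ⊕ dot F a′ (_·ᵥ_ F c x′)
      ≡⟨ cong₂ _⊕_ (x∙yz≈y∙xz (a zero) c (x zero)) (dot-scale a′ c x′) ⟩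
    c ⊛ (a zero ⊛ x zero) ⊕ c ⊛ dot F a′ x′
      ≡⟨ sym (distribˡ c _ _) ⟩
    c ⊛ (a zero ⊛ x zero ⊕ dot F a′ x′) ∎
    where
    open ≡-Reasoning
    a′ x′ : Defs.Vec F m
    a′ i = a (suc i)
    x′ i = x (suc i)

  dot-extend : ∀ {k} (α : Defs.Vec F (suc k)) (x : Defs.Vec F k) (c : Carrier) →
               dot F α (extend F x c) ≡ dot F (λ i → α (inject₁ i)) x ⊕ α (fromℕ k) ⊛ c
  dot-extend {zero}  α x c = trans (+-identityʳ _) (sym (+-identityˡ _))
  dot-extend {suc k} α x c =
    trans (cong (α zero ⊛ x zero ⊕_) (dot-extend (λ i → α (suc i)) (λ i → x (suc i)) c))
          (sym (+-assoc _ _ _))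

  scale-injective : ∀ c → ¬ c ≡ 0# → ∀ {u v} → c ⊛ u ≡ c ⊛ v → u ≡ v
  scale-injective c c≢0 {u} {v} cu≡cv = trans (sym (unscale u)) (trans (cong (c ⁻¹ ⊛_) cu≡cv) (unscale v))
    where
    unscale : ∀ w → c ⁻¹ ⊛ (c ⊛ w) ≡ w
    unscale w = trans (sym (*-assoc _ _ _))
                (trans (cong (_⊛ w) (trans (*-comm _ _) (inverse c c≢0))) (*-identityˡ w))

  +≡0⇒≡- : ∀ x b → x ⊕ b ≡ 0# → x ≡ - b
  +≡0⇒≡- = +-inverseˡ-unique

  ≡-⇒+≡0 : ∀ x b → x ≡ - b → x ⊕ b ≡ 0#
  ≡-⇒+≡0 x b refl = -‿inverseˡ b

  -≢0 : ∀ b → ¬ b ≡ 0# → ¬ - b ≡ 0#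
  -≢0 b b≢0 -b≡0 = b≢0 (-‿injective (trans -b≡0 (sym -0#≈0#)))

  weight-map : ∀ {A : Set} (h : A → Carrier) (xs : List A) →
               weight F (map h xs) ≡ count (λ x → ¬? (h x ≟ 0#)) xs
  weight-map h []       = refl
  weight-map h (x ∷ xs) with h x ≟ 0#
  ... | yes _ = weight-map h xs
  ... | no  _ = cong suc (weight-map h xs)

  weight-++ : ∀ xs ys → weight F (xs ++ ys) ≡ weight F xs + weight F ys
  weight-++ xs ys = trans (cong length (filter-++ (λ x → ¬? (x ≟ 0#)) xs ys)) (length-++ (filter _ xs))

  affineCodeword : ∀ {k} → List (Defs.Vec F k) → Defs.Vec F k → Carrier → List Carrier
  affineCodeword D a b = map (λ x → dot F a x ⊕ b) D

  affine-0# : ∀ {k} (D : List (Defs.Vec F k)) (a : Defs.Vec F k) →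
              affineCodeword D a 0# ≡ codeword F D a
  affine-0# D a = map-cong (λ x → +-identityʳ (dot F a x)) D

  half-affine : ∀ {k} (D : List (Defs.Vec F k)) (α : Defs.Vec F (suc k)) (c : Carrier) →
                map (λ x → dot F α (extend F x c)) D
                  ≡ affineCodeword D (λ i → α (inject₁ i)) (α (fromℕ k) ⊛ c)
  half-affine D α c = map-cong (λ x → dot-extend α x c) D

  weight-tildeDD : ∀ {k} (D : List (Defs.Vec F k)) (α : Defs.Vec F (suc k)) →
    weight F (codeword F (tildeDD F D) α)
      ≡ weight F (map (λ x → dot F α (extend F x 1#)) D) + weight F (map (λ x → dot F α (extend F x 0#)) D)
  weight-tildeDD D α = begin
    weight F (map (dot F α) (map (with-last 1#) D ++ map (with-last 0#) D))
      ≡⟨ cong (weight F) (map-++ (dot F α) (map (with-last 1#) D) _) ⟩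
    weight F (map (dot F α) (map (with-last 1#) D) ++ map (dot F α) (map (with-last 0#) D))
      ≡⟨ weight-++ (map (dot F α) (map (with-last 1#) D)) _ ⟩
    weight F (map (dot F α) (map (with-last 1#) D)) + weight F (map (dot F α) (map (with-last 0#) D))
      ≡⟨ cong₂ _+_ (cong (weight F) (map-∘ D)) (cong (weight F) (map-∘ D)) ⟨
    weight F (map (λ x → dot F α (extend F x 1#)) D) + weight F (map (λ x → dot F α (extend F x 0#)) D) ∎
    where
    open ≡-Reasoning
    with-last : Carrier → Defs.Vec F _ → Defs.Vec F (suc _)
    with-last c x = extend F x c

  nonzeros : List Carrier
  nonzeros = filter (λ t → ¬? (t ≟ 0#)) elements

  nonzeros-unique : Unique nonzeros
  nonzeros-unique = UniqueP.filter⁺ _ distinct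

  nonzero⇒∈nonzeros : ∀ {t} → ¬ t ≡ 0# → t ∈ nonzeros
  nonzero⇒∈nonzeros {t} = ∈-filter⁺ (λ t → ¬? (t ≟ 0#)) (complete t)

  nonzeros-nonzero : All (λ t → ¬ t ≡ 0#) nonzeros
  nonzeros-nonzero = AllP.all-filter (λ t → ¬? (t ≟ 0#)) elements

  order≡1+nonzeros : order ≡ suc (length nonzeros)
  order≡1+nonzeros = trans (count-complement (λ t → t ≟ 0#) elements)
    (cong (_+ length nonzeros) (count-unique (λ t → t ≟ 0#) refl (λ t t≡0 → t≡0) distinct (complete 0#)))

  2≤order : 2 ≤ order
  2≤order = subst (2 ≤_) (sym order≡1+nonzeros)
                  (s≤s (∈-length (nonzero⇒∈nonzeros (λ 1≡0 → 0≢1 (sym 1≡0)))))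

module LevelSets (F : FiniteField) {k : ℕ} (D : List (Defs.Vec F k)) (D! : NoDup F D)
  (scale-closed : ∀ a → ¬ (a ≡ FiniteField.0# F) → ∀ x → _∈ᵥ_ F x D → _∈ᵥ_ F (_·ᵥ_ F a x) D)
  (a : Defs.Vec F k) where
  open FiniteField F renaming (_+_ to _⊕_; _*_ to _⊛_)
  open FieldFacts F
  open CommutativeRing commutativeRing using (*-assoc; *-comm; *-identityʳ; zeroˡ)
  open import Data.List.Membership.Setoid (vecSetoid k) using () renaming (_∈_ to _∈ₛ_)
  open import Data.List.Membership.Setoid.Properties using ()
    renaming (∈-filter⁺ to ∈ₛ-filter⁺; ∈-filter⁻ to ∈ₛ-filter⁻)
  open Pigeonhole (vecSetoid k) using (length-≤)

  levelSet : Carrier → List (Defs.Vec F k)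
  levelSet t = filter (λ x → dot F a x ≟ t) D

  level : Carrier → ℕ
  level t = length (levelSet t)

  level-resp : ∀ t {x y} → _≈_ F x y → dot F a x ≡ t → dot F a y ≡ t
  level-resp t x≈y ax≡t = trans (sym (dot-resp a x≈y)) ax≡t

  -- Scaling by s t⁻¹ maps the level set at t injectively into the one at s.
  level-≤ : ∀ {t s} → ¬ t ≡ 0# → ¬ s ≡ 0# → level t ≤ level s
  level-≤ {t} {s} t≢0 s≢0 =
    subst (_≤ level s) (length-map (_·ᵥ_ F c) (levelSet t))
      (length-≤ (SetoidUniqueP.map⁺ (vecSetoid k) (vecSetoid k) (λ e i → scale-injective c c≢0 (e i))
                   (SetoidUniqueP.filter⁺ (vecSetoid k) (λ x → dot F a x ≟ t) D!))
                (AllP.map⁺ (All.tabulateₛ (vecSetoid k) scaled-member)))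
    where
    c : Carrier
    c = s ⊛ t ⁻¹

    c⊛t≡s : c ⊛ t ≡ s
    c⊛t≡s = trans (*-assoc s (t ⁻¹) t)
              (trans (cong (s ⊛_) (trans (*-comm (t ⁻¹) t) (inverse t t≢0))) (*-identityʳ s))

    c≢0 : ¬ c ≡ 0#
    c≢0 c≡0 = s≢0 (trans (sym c⊛t≡s) (trans (cong (_⊛ t) c≡0) (zeroˡ t)))

    scaled-member : ∀ {x} → x ∈ₛ levelSet t → _·ᵥ_ F c x ∈ₛ levelSet s
    scaled-member x∈Dt with ∈ₛ-filter⁻ (vecSetoid k) (λ x → dot F a x ≟ t) (level-resp t) x∈Dt
    ... | x∈D , ax≡t =
      ∈ₛ-filter⁺ (vecSetoid k) (λ x → dot F a x ≟ s) (level-resp s)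
        (scale-closed c c≢0 _ x∈D) (trans (dot-scale a c _) (trans (cong (c ⊛_) ax≡t) c⊛t≡s))

  level-≡ : ∀ {t s} → ¬ t ≡ 0# → ¬ s ≡ 0# → level t ≡ level s
  level-≡ t≢0 s≢0 = ≤-antisym (level-≤ t≢0 s≢0) (level-≤ s≢0 t≢0)

  -- The weight of the codeword of a is the sum of the q - 1 equal nonzero
  -- level sizes.
  weight-by-levels : ∀ {s} → ¬ s ≡ 0# → weight F (codeword F D a) ≡ (order ∸ 1) * level s
  weight-by-levels {s} s≢0 = begin
    weight F (map (dot F a) D)            ≡⟨ weight-map (dot F a) D ⟩
    count (λ x → ¬? (dot F a x ≟ 0#)) D   ≡⟨ count-by-fibres (dot F a) D ⟩
    sum (map level nonzeros)              ≡⟨ sum-map-const level (level s) all-levels-equal ⟩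
    length nonzeros * level s             ≡⟨ cong (λ q → (q ∸ 1) * level s) order≡1+nonzeros ⟨
    (order ∸ 1) * level s                 ∎
    where
    open ≡-Reasoning
    open Fibres _≟_ (λ t → ¬? (t ≟ 0#)) nonzeros nonzeros-unique nonzero⇒∈nonzeros nonzeros-nonzero
    all-levels-equal : All (λ t → level t ≡ level s) nonzeros
    all-levels-equal = All.map (λ t≢0 → level-≡ t≢0 s≢0) nonzeros-nonzero

  -- The zeros of the affine codeword with constant b are the points of the
  -- level set at -b; all other entries count towards its weight.
  length≡level+weight-affine : ∀ b → length D ≡ level (- b) + weight F (affineCodeword D a b)
  length≡level+weight-affine b = trans (count-complement (λ x → (dot F a x ⊕ b) ≟ 0#) D)
    (cong₂ _+_ (count-≐ (λ x → (dot F a x ⊕ b) ≟ 0#) (λ x → dot F a x ≟ (- b)) shifted-zero⇔level D)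
               (sym (weight-map (λ x → dot F a x ⊕ b) D)))
    where
    shifted-zero⇔level : (λ x → dot F a x ⊕ b ≡ 0#) ≐ (λ x → dot F a x ≡ - b)
    shifted-zero⇔level = (λ {x} → +≡0⇒≡- (dot F a x) b) , (λ {x} → ≡-⇒+≡0 (dot F a x) b)

weight-identity : ∀ {q} → 2 ≤ q → ∀ {n N w₁ W} → n ≡ N + w₁ → W ≡ (q ∸ 1) * N →
                  (q ∸ 1) * (w₁ + W) ≡ (q ∸ 1) * n + (q ∸ 2) * W
weight-identity {suc (suc r)} (s≤s (s≤s _)) {N = N} {w₁} refl refl =
  solve 3 (λ r N w₁ → (con 1 :+ r) :* (w₁ :+ (con 1 :+ r) :* N)
                      := (con 1 :+ r) :* (N :+ w₁) :+ r :* ((con 1 :+ r) :* N)) refl r N w₁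
  where open +-*-Solver

proposition13 : (F : FiniteField) → let open FiniteField F using (0#) in
  (k : ℕ) → 2 ≤ k → (D : List (Defs.Vec F k)) →
  NoDup F D →
  All (λ x → ¬ (_≈_ F x (zeroV F))) D →
  VectorialCuttingBlockingSet F k D →
  (∀ a → ¬ (a ≡ 0#) → ∀ x → _∈ᵥ_ F x D → _∈ᵥ_ F (_·ᵥ_ F a x) D) →
  (∀ a → ¬ (a ≡ 0#) → ∀ y → _∈ᵥ_ F y D →
    Σ (Defs.Vec F k) (λ x → _∈ᵥ_ F x D × _≈_ F y (_·ᵥ_ F a x))) →
  (α : Defs.Vec F (suc k)) →
  let n    = length D
      q    = FiniteField.order F
      c₀   = map (λ x → dot F α (extend F x 0#)) D
      c₁   = map (λ x → dot F α (extend F x (FiniteField.1# F))) D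
      cα   = codeword F (tildeDD F D) α
      cα~  = codeword F D (λ i → α (inject₁ i))
  in (α (fromℕ k) ≡ 0# →
        (weight F c₁ ≡ weight F c₀) × (weight F cα ≡ 2 * weight F cα~))
   × (¬ (α (fromℕ k) ≡ 0#) →
        (q ∸ 1) * weight F cα ≡ (q ∸ 1) * n + (q ∸ 2) * weight F cα~)
proposition13 F k _ D D! _ _ scale-closed _ α = last-zero , last-nonzero
  where
  open FiniteField F using (Carrier; 0#; 1#; order)
  open FieldFacts F
  open CommutativeRing commutativeRing using (*-identityʳ; zeroʳ)
  α~ : Defs.Vec F k
  α~ i = α (inject₁ i)
  b : Carrier
  b = α (fromℕ k)
  W : ℕ
  W = weight F (codeword F D α~)
  open LevelSets F D D! scale-closed α~ using (weight-by-levels; length≡level+weight-affine)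

  w₀ : weight F (map (λ x → dot F α (extend F x 0#)) D) ≡ W
  w₀ = cong (weight F)
    (trans (half-affine D α 0#) (trans (cong (affineCodeword D α~) (zeroʳ b)) (affine-0# D α~)))
  w₁ : weight F (map (λ x → dot F α (extend F x 1#)) D) ≡ weight F (affineCodeword D α~ b)
  w₁ = cong (weight F) (trans (half-affine D α 1#) (cong (affineCodeword D α~) (*-identityʳ b)))
  wα : weight F (codeword F (tildeDD F D) α) ≡ weight F (affineCodeword D α~ b) + W
  wα = trans (weight-tildeDD D α) (cong₂ _+_ w₁ w₀)

  last-zero : b ≡ 0# →
    (weight F (map (λ x → dot F α (extend F x 1#)) D) ≡ weight F (map (λ x → dot F α (extend F x 0#)) D))
    × (weight F (codeword F (tildeDD F D) α) ≡ 2 * W)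
  last-zero b≡0 = trans w₁ (trans w₁₀ (sym w₀))
                , trans wα (trans (cong (_+ W) w₁₀) (cong (W +_) (sym (+-identityʳ-ℕ W))))
    where
    w₁₀ : weight F (affineCodeword D α~ b) ≡ W
    w₁₀ = cong (weight F) (trans (cong (affineCodeword D α~) b≡0) (affine-0# D α~))

  last-nonzero : ¬ b ≡ 0# →
    (order ∸ 1) * weight F (codeword F (tildeDD F D) α) ≡ (order ∸ 1) * length D + (order ∸ 2) * W
  last-nonzero b≢0 = trans (cong ((order ∸ 1) *_) wα)
    (weight-identity 2≤order (length≡level+weight-affine b) (weight-by-levels (-≢0 b b≢0)))
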